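{- Let $\Pi$ be an $LS_{BBI}$ derivation of a sequent $\Gamma\vdash\Delta$, let $x$ be a label with $x\neq\epsilon$ and let $y$ be any label. Then there is an $LS_{BBI}$ derivation $\Pi'$ of $\Gamma[y/x]\vdash\Delta[y/x]$ (every occurrence of $x$ replaced by $y$) with $ht(\Pi')\le ht(\Pi)$.
   Context: BBI formulae: $A ::= p \mid \top \mid \bot \mid \neg A \mid A\lor A \mid A\land A \mid A\to A \mid \top^* \mid A * A \mid A \mathrel{ -\!*} A$, $p$ atomic; $\neg A$ abbreviates $A\to\bot$ and $A\lor B$ abbreviates $\neg(\neg A\land\neg B)$. Labels are label variables (from an infinite set $LVar$) or the constant $\epsilon$. A labelled formula is $w:A$; a relational atom is $(x,y\triangleright z)$ for labels $x,y,z$. A sequent $\Gamma\vdash\Delta$ has $\Gamma$ a finite multiset of labelled formulae and relational atoms and $\Delta$ a finite multiset of labelled formulae; ";" is multiset union. $\Gamma[y/x]$ replaces every occurrence of label $x$ by $y$. The height $ht(\Pi)$ of a derivation is the length of a longest branch in its derivation tree. Rules of $LS_{BBI}$ ("from premises infer conclusion"; $P$ atomic): id: infer $\Gamma;w:P\vdash w:P;\Delta$. $\bot L$: infer $\Gamma;w:\bot\vdash\Delta$. $\top R$: infer $\Gamma\vdash w:\top;\Delta$. $\top^*R$: infer $\Gamma\vdash\epsilon:\top^*;\Delta$. cut: from $\Gamma\vdash x:A;\Delta$ and $\Gamma';x:A\vdash\Delta'$ infer $\Gamma;\Gamma'\vdash\Delta;\Delta'$. $\top^*L$: from $\Gamma[\epsilon/w]\vdash\Delta[\epsilon/w]$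 infer $\Gamma;w:\top^*\vdash\Delta$ ($w\neq\epsilon$). $\land L$: from $\Gamma;w:A;w:B\vdash\Delta$ infer $\Gamma;w:A\land B\vdash\Delta$. $\land R$: from $\Gamma\vdash w:A;\Delta$ and $\Gamma\vdash w:B;\Delta$ infer $\Gamma\vdash w:A\land B;\Delta$. $\to L$: from $\Gamma\vdash w:A;\Delta$ and $\Gamma;w:B\vdash\Delta$ infer $\Gamma;w:A\to B\vdash\Delta$. $\to R$: from $\Gamma;w:A\vdash w:B;\Delta$ infer $\Gamma\vdash w:A\to B;\Delta$. $*L$: from $(x,y\triangleright z);\Gamma;x:A;y:B\vdash\Delta$ infer $\Gamma;z:A*B\vdash\Delta$ ($x,y$ not in the conclusion). $\mathrel{ -\!*}R$: from $(x,y\triangleright z);\Gamma;x:A\vdash z:B;\Delta$ infer $\Gamma\vdash y:A\mathrel{ -\!*}B;\Delta$ ($x,z$ not in the conclusion). $*R$: from $(x,y\triangleright z);\Gamma\vdash x:A;z:A*B;\Delta$ and $(x,y\triangleright z);\Gamma\vdash y:B;z:A*B;\Delta$ infer $(x,y\triangleright z);\Gamma\vdash z:A*B;\Delta$. $\mathrel{ -\!*}L$: from $(x,y\triangleright z);\Gamma;y:A\mathrel{ -\!*}B\vdash x:A;\Delta$ and $(x,y\triangleright z);\Gamma;y:A\mathrel{ -\!*}B;z:B\vdash\Delta$ infer $(x,y\triangleright z);\Gamma;y:A\mathrel{ -\!*}B\vdash\Delta$. E: from $(y,x\triangleright z);(x,y\triangleright z);\Gamma\vdash\Delta$ infer $(x,y\triangleright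 z);\Gamma\vdash\Delta$. U: from $(x,\epsilon\triangleright x);\Gamma\vdash\Delta$ infer $\Gamma\vdash\Delta$. A: from $(u,w\triangleright z);(y,v\triangleright w);(x,y\triangleright z);(u,v\triangleright x);\Gamma\vdash\Delta$ infer $(x,y\triangleright z);(u,v\triangleright x);\Gamma\vdash\Delta$ ($w$ not in the conclusion). $A_C$: from $(x,w\triangleright x);(y,y\triangleright w);(x,y\triangleright x);\Gamma\vdash\Delta$ infer $(x,y\triangleright x);\Gamma\vdash\Delta$ ($w$ not in the conclusion). $Eq_1$: from $(\epsilon,w'\triangleright w');\Gamma[w'/w]\vdash\Delta[w'/w]$ infer $(\epsilon,w\triangleright w');\Gamma\vdash\Delta$ ($w\neq\epsilon$). $Eq_2$: from $(\epsilon,w'\triangleright w');\Gamma[w'/w]\vdash\Delta[w'/w]$ infer $(\epsilon,w'\triangleright w);\Gamma\vdash\Delta$ ($w\neq\epsilon$). -}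

module Defs where

open import Data.Nat using (ℕ; zero; suc; _⊔_; _≤_)
open import Data.Nat.Properties using () renaming (_≟_ to _≟ℕ_)
open import Data.List using (List; []; _∷_; _++_; map; concatMap)
open import Data.List.Membership.Propositional using (_∈_)
open import Data.List.Relation.Binary.Permutation.Propositional using (_↭_)
open import Data.Product using (_×_; _,_)
open import Relation.Binary.PropositionalEquality using (_≡_; _≢_; refl; cong)
open import Relation.Nullary using (¬_; Dec; yes; no)

infixr 6 _∧_
infixr 5 _⇒_
infixr 7 _✱_
infixr 5 _-✱_

data Formula : Set where
  atom : ℕ → Formula
  ⊤ᶠ   : Formula
  ⊥ᶠ   : Formula
  _∧_  : Formula → Formula → Formula
  _⇒_  : Formula → Formula → Formula
  ⊤*   : Formula
  _✱_  : Formula → Formula → Formula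
  _-✱_ : Formula → Formula → Formula

¬ᶠ_ : Formula → Formula
¬ᶠ A = A ⇒ ⊥ᶠ

_∨_ : Formula → Formula → Formula
A ∨ B = ¬ᶠ ((¬ᶠ A) ∧ (¬ᶠ B))

data Label : Set where
  ε   : Label
  var : ℕ → Label

_≟L_ : (a b : Label) → Dec (a ≡ b)
ε ≟L ε = yes refl
ε ≟L var _ = no (λ ())
var _ ≟L ε = no (λ ())
var m ≟L var n with m ≟ℕ n
... | yes refl = yes refl
... | no m≢n = no (λ { refl → m≢n refl })

data Hyp : Set where
  lf  : Label → Formula → Hyp
  rel : Label → Label → Label → Hyp       -- (x , y ▷ z)

LF : Set
LF = Label × Formula

subL : Label → Label → Label → Label
subL y x l with l ≟L x
... | yes _ = y
... | no  _ = l

subH : Label → Label → Hyp → Hyp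
subH y x (lf w A)      = lf (subL y x w) A
subH y x (rel a b c)   = rel (subL y x a) (subL y x b) (subL y x c)

subLF : Label → Label → LF → LF
subLF y x (w , A) = (subL y x w , A)

subΓ : Label → Label → List Hyp → List Hyp
subΓ y x = map (subH y x)

subΔ : Label → Label → List LF → List LF
subΔ y x = map (subLF y x)

labelsH : Hyp → List Label
labelsH (lf w _)    = w ∷ []
labelsH (rel a b c) = a ∷ b ∷ c ∷ []

labelsLF : LF → List Label
labelsLF (w , _) = w ∷ []

labels : List Hyp → List LF → List Label
labels Γ Δ = concatMap labelsH Γ ++ concatMap labelsLF Δ

Fresh : ℕ → List Hyp → List LF → Set
Fresh i Γ Δ = ¬ (var i ∈ labels Γ Δ)

-- Sequents Γ ⊢ Δ are multisets, represented by
-- lists; "Γ ; X" in a conclusion is expressed by a permutation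
-- (Γc ↭ X ∷ Γ₀), or by membership when the principal item is kept
-- in the premises.

data Der : List Hyp → List LF → Set where
  id   : ∀ {Γ Δ w p} → lf w (atom p) ∈ Γ → (w , atom p) ∈ Δ → Der Γ Δ
  ⊥L   : ∀ {Γ Δ w} → lf w ⊥ᶠ ∈ Γ → Der Γ Δ
  ⊤R   : ∀ {Γ Δ w} → (w , ⊤ᶠ) ∈ Δ → Der Γ Δ
  ⊤*R  : ∀ {Γ Δ} → (ε , ⊤*) ∈ Δ → Der Γ Δ
  cut  : ∀ {Γc Δc Γ Γ' Δ Δ' x A} →
         Γc ↭ Γ ++ Γ' → Δc ↭ Δ ++ Δ' →
         Der Γ ((x , A) ∷ Δ) → Der (lf x A ∷ Γ') Δ' → Der Γc Δc
  ⊤*L  : ∀ {Γc Γ Δ w} → w ≢ ε → Γc ↭ lf w ⊤* ∷ Γ →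
         Der (subΓ ε w Γ) (subΔ ε w Δ) → Der Γc Δ
  ∧L   : ∀ {Γc Γ Δ w A B} → Γc ↭ lf w (A ∧ B) ∷ Γ →
         Der (lf w A ∷ lf w B ∷ Γ) Δ → Der Γc Δ
  ∧R   : ∀ {Γ Δc Δ w A B} → Δc ↭ (w , A ∧ B) ∷ Δ →
         Der Γ ((w , A) ∷ Δ) → Der Γ ((w , B) ∷ Δ) → Der Γ Δc
  ⇒L   : ∀ {Γc Γ Δ w A B} → Γc ↭ lf w (A ⇒ B) ∷ Γ →
         Der Γ ((w , A) ∷ Δ) → Der (lf w B ∷ Γ) Δ → Der Γc Δ
  ⇒R   : ∀ {Γ Δc Δ w A B} → Δc ↭ (w , A ⇒ B) ∷ Δ →
         Der (lf w A ∷ Γ) ((w , B) ∷ Δ) → Der Γ Δc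
  ✱L   : ∀ {Γc Γ Δ z A B} (i j : ℕ) → Γc ↭ lf z (A ✱ B) ∷ Γ →
         Fresh i Γc Δ → Fresh j Γc Δ → i ≢ j →
         Der (rel (var i) (var j) z ∷ lf (var i) A ∷ lf (var j) B ∷ Γ) Δ →
         Der Γc Δ
  -✱R  : ∀ {Γ Δc Δ y A B} (i k : ℕ) → Δc ↭ (y , A -✱ B) ∷ Δ →
         Fresh i Γ Δc → Fresh k Γ Δc → i ≢ k →
         Der (rel (var i) y (var k) ∷ lf (var i) A ∷ Γ) ((var k , B) ∷ Δ) →
         Der Γ Δc
  ✱R   : ∀ {Γ Δ x y z A B} → rel x y z ∈ Γ → (z , A ✱ B) ∈ Δ →
         Der Γ ((x , A) ∷ Δ) → Der Γ ((y , B) ∷ Δ) → Der Γ Δ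
  -✱L  : ∀ {Γ Δ x y z A B} → rel x y z ∈ Γ → lf y (A -✱ B) ∈ Γ →
         Der Γ ((x , A) ∷ Δ) → Der (lf z B ∷ Γ) Δ → Der Γ Δ
  E    : ∀ {Γ Δ x y z} → rel x y z ∈ Γ →
         Der (rel y x z ∷ Γ) Δ → Der Γ Δ
  U    : ∀ {Γ Δ} (x : Label) → Der (rel x ε x ∷ Γ) Δ → Der Γ Δ
  A    : ∀ {Γ Δ x y z u v} (w : ℕ) → rel x y z ∈ Γ → rel u v x ∈ Γ →
         Fresh w Γ Δ →
         Der (rel u (var w) z ∷ rel y v (var w) ∷ Γ) Δ → Der Γ Δ
  AC   : ∀ {Γ Δ x y} (w : ℕ) → rel x y x ∈ Γ → Fresh w Γ Δ →
         Der (rel x (var w) x ∷ rel y y (var w) ∷ Γ) Δ → Der Γ Δ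
  Eq₁  : ∀ {Γc Γ Δ w w'} → w ≢ ε → Γc ↭ rel ε w w' ∷ Γ →
         Der (rel ε w' w' ∷ subΓ w' w Γ) (subΔ w' w Δ) → Der Γc Δ
  Eq₂  : ∀ {Γc Γ Δ w w'} → w ≢ ε → Γc ↭ rel ε w' w ∷ Γ →
         Der (rel ε w' w' ∷ subΓ w' w Γ) (subΔ w' w Δ) → Der Γc Δ

ht : ∀ {Γ Δ} → Der Γ Δ → ℕ
ht (id _ _)             = 1
ht (⊥L _)               = 1
ht (⊤R _)               = 1
ht (⊤*R _)              = 1
ht (cut _ _ d e)        = suc (ht d ⊔ ht e)
ht (⊤*L _ _ d)          = suc (ht d)
ht (∧L _ d)             = suc (ht d)
ht (∧R _ d e)           = suc (ht d ⊔ ht e)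
ht (⇒L _ d e)           = suc (ht d ⊔ ht e)
ht (⇒R _ d)             = suc (ht d)
ht (✱L _ _ _ _ _ _ d)   = suc (ht d)
ht (-✱R _ _ _ _ _ _ d)  = suc (ht d)
ht (✱R _ _ d e)         = suc (ht d ⊔ ht e)
ht (-✱L _ _ d e)        = suc (ht d ⊔ ht e)
ht (E _ d)              = suc (ht d)
ht (U _ d)              = suc (ht d)
ht (A _ _ _ _ d)        = suc (ht d)
ht (AC _ _ _ d)         = suc (ht d)
ht (Eq₁ _ _ d)          = suc (ht d)
ht (Eq₂ _ _ d)          = suc (ht d)

-- The induction needs a stronger statement: any renaming ρ of label variables
-- (ε is fixed), together with weakening by extra hypotheses and conclusions, is
-- height-preserving admissible; [y/x] is the renaming sending x to y.
-- Eigenvariables of ✱L, -✱R, A and A_C are renamed apart from the new sequent,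
-- which does not change the conclusion since they were fresh in it.  The rules
-- ⊤*L, Eq₁ and Eq₂ substitute [c/e] in their premise; the premise is renamed by
-- τ = [ρc/ρe] ∘ ρ, which is again a renaming when ρe ≠ ε and satisfies
-- τ ∘ [c/e] = [ρc/ρe] ∘ ρ, so the same rule applies to the renamed conclusion.
-- If ρe = ε but ρc ≠ ε, Eq₁ and Eq₂ trade places with c and e swapped; if both
-- are sent to ε, the rule is dropped and its premise already derives the
-- renamed conclusion, up to weakening by the principal hypothesis of ⊤*L.
module Submission where

open import Defs
open import Data.Nat using (ℕ; suc; _≤_; s≤s)
open import Data.Nat.Properties
  using (≤-refl; ≤-trans; ⊔-mono-≤; m≤n⇒m≤1+n; 1+n≰n) renaming (_≟_ to _≟ℕ_)
open import Data.List using (List; []; _∷_; _++_; map; concatMap)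
open import Data.List.Properties using (map-++; map-cong; map-cong-local; map-∘)
open import Data.List.Extrema.Nat using (max; xs≤max)
open import Data.List.Relation.Unary.All as All using ()
open import Data.List.Relation.Unary.Any using (here; there)
open import Data.List.Membership.Propositional using (_∈_; _∉_; lose)
open import Data.List.Membership.Propositional.Properties
  using (∈-map⁺; ∈-++⁺ˡ; ∈-++⁺ʳ; ∈-concatMap⁺)
open import Data.List.Relation.Binary.Permutation.Propositional
  using (_↭_; ↭-refl; ↭-sym; ↭-trans; ↭-reflexive; prep)
open import Data.List.Relation.Binary.Permutation.Propositional.Properties
  using (map⁺; ++⁺ʳ; shift; ∈-resp-↭; ++-identityʳ; ++-assoc)
open import Data.Product using (Σ; _,_; proj₁; proj₂)
open import Data.Sum using (_⊎_; inj₁; inj₂; swap)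
open import Data.Empty using (⊥-elim)
open import Function using (_∘_)
open import Relation.Binary.PropositionalEquality
  using (_≡_; _≢_; _≗_; refl; sym; trans; cong; subst; module ≡-Reasoning)
open import Relation.Nullary using (yes; no)

Der≤ : List Hyp → List LF → ℕ → Set
Der≤ Γ Δ n = Σ (Der Γ Δ) (λ d → ht d ≤ n)

subL-self : ∀ y x → subL y x x ≡ y
subL-self y x with x ≟L x
... | yes _ = refl
... | no x≢x = ⊥-elim (x≢x refl)

subL-other : ∀ {y x l} → l ≢ x → subL y x l ≡ l
subL-other {y} {x} {l} l≢x with l ≟L x
... | yes l≡x = ⊥-elim (l≢x l≡x)
... | no _ = refl

subL-ε : ∀ {y x} → x ≢ ε → subL y x ε ≡ ε
subL-ε x≢ε = subL-other (x≢ε ∘ sym)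

subL-target : ∀ y x → subL y x y ≡ y
subL-target y x with y ≟L x
... | yes _ = refl
... | no _ = refl

subL-absorb : ∀ (g : Label → Label) {a b} → g a ≡ g b → ∀ l → g (subL a b l) ≡ g l
subL-absorb g {a} {b} ga≡gb l with l ≟L b
... | yes refl = ga≡gb
... | no _ = refl

ren : (ℕ → Label) → Label → Label
ren ρ ε = ε
ren ρ (var n) = ρ n

_[_≔_] : (ℕ → Label) → ℕ → Label → ℕ → Label
(ρ [ i ≔ t ]) n with n ≟ℕ i
... | yes _ = t
... | no _ = ρ n

ren-update-≡ : ∀ ρ i t → ren (ρ [ i ≔ t ]) (var i) ≡ t
ren-update-≡ ρ i t with i ≟ℕ i
... | yes _ = refl
... | no i≢i = ⊥-elim (i≢i refl)

ren-update-≢ : ∀ {ρ i t} l → l ≢ var i → ren (ρ [ i ≔ t ]) l ≡ ren ρ l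
ren-update-≢ ε _ = refl
ren-update-≢ {i = i} (var n) n≢i with n ≟ℕ i
... | yes refl = ⊥-elim (n≢i refl)
... | no _ = refl

_⨾[_/_] : (ℕ → Label) → Label → Label → ℕ → Label
(ρ ⨾[ c / e ]) n = subL c e (ρ n)

ren-⨾ : ∀ {ρ c e} → e ≢ ε → ∀ l → ren (ρ ⨾[ c / e ]) l ≡ subL c e (ren ρ l)
ren-⨾ e≢ε ε = sym (subL-ε e≢ε)
ren-⨾ e≢ε (var n) = refl

ren-var-⨾ : ∀ {y x} → x ≢ ε → ∀ l → ren (var ⨾[ y / x ]) l ≡ subL y x l
ren-var-⨾ x≢ε ε = sym (subL-ε x≢ε)
ren-var-⨾ x≢ε (var n) = refl

mapH : (Label → Label) → Hyp → Hyp
mapH f (lf w φ) = lf (f w) φ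
mapH f (rel a b c) = rel (f a) (f b) (f c)

mapLF : (Label → Label) → LF → LF
mapLF f (w , φ) = (f w , φ)

mapΓ : (Label → Label) → List Hyp → List Hyp
mapΓ f = map (mapH f)

mapΔ : (Label → Label) → List LF → List LF
mapΔ f = map (mapLF f)

rel-cong : ∀ {a a' b b' c c'} → a ≡ a' → b ≡ b' → c ≡ c' → rel a b c ≡ rel a' b' c'
rel-cong refl refl refl = refl

mapH-∘ : ∀ f g h → mapH f (mapH g h) ≡ mapH (f ∘ g) h
mapH-∘ f g (lf w φ) = refl
mapH-∘ f g (rel a b c) = refl

mapLF-∘ : ∀ f g e → mapLF f (mapLF g e) ≡ mapLF (f ∘ g) e
mapLF-∘ f g (w , φ) = refl

mapH-cong-on : ∀ {f g} h → (∀ {l} → l ∈ labelsH h → f l ≡ g l) → mapH f h ≡ mapH g h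
mapH-cong-on (lf w φ) agree = cong (λ t → lf t φ) (agree (here refl))
mapH-cong-on (rel a b c) agree =
  rel-cong (agree (here refl)) (agree (there (here refl))) (agree (there (there (here refl))))

mapLF-cong-on : ∀ {f g} e → (∀ {l} → l ∈ labelsLF e → f l ≡ g l) → mapLF f e ≡ mapLF g e
mapLF-cong-on (w , φ) agree = cong (λ t → (t , φ)) (agree (here refl))

subH≗mapH : ∀ y x → subH y x ≗ mapH (subL y x)
subH≗mapH y x (lf w φ) = refl
subH≗mapH y x (rel a b c) = refl

subLF≗mapLF : ∀ y x → subLF y x ≗ mapLF (subL y x)
subLF≗mapLF y x (w , φ) = refl

module LabelledList
  {I : Set} (mapI : (Label → Label) → I → I) (labelsI : I → List Label)
  (subI : Label → Label → I → I)
  (mapI-∘ : ∀ f g i → mapI f (mapI g i) ≡ mapI (f ∘ g) i)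
  (mapI-cong-on : ∀ {f g} i → (∀ {l} → l ∈ labelsI i → f l ≡ g l) → mapI f i ≡ mapI g i)
  (subI≗mapI : ∀ y x → subI y x ≗ mapI (subL y x))
  where

  map-cong-on : ∀ {f g} xs → (∀ {l} → l ∈ concatMap labelsI xs → f l ≡ g l) →
                map (mapI f) xs ≡ map (mapI g) xs
  map-cong-on xs agree =
    map-cong-local (All.tabulate λ i∈xs → mapI-cong-on _ λ l∈i → agree (∈-concatMap⁺ labelsI (lose i∈xs l∈i)))

  map-∘-cong : ∀ {f g k} → f ∘ g ≗ k → ∀ xs → map (mapI f) (map (mapI g) xs) ≡ map (mapI k) xs
  map-∘-cong {f} {g} {k} fg≗k xs = begin
    map (mapI f) (map (mapI g) xs)  ≡⟨ map-∘ xs ⟨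
    map (mapI f ∘ mapI g) xs        ≡⟨ map-cong (λ i → trans (mapI-∘ f g i) (mapI-cong-on i λ _ → fg≗k _)) xs ⟩
    map (mapI k) xs                 ∎
    where open ≡-Reasoning

  map-sub-absorb : ∀ f {a b} → f a ≡ f b → ∀ xs → map (mapI f) (map (subI a b) xs) ≡ map (mapI f) xs
  map-sub-absorb f {a} {b} fa≡fb xs = begin
    map (mapI f) (map (subI a b) xs)          ≡⟨ cong (map (mapI f)) (map-cong (subI≗mapI a b) xs) ⟩
    map (mapI f) (map (mapI (subL a b)) xs)   ≡⟨ map-∘-cong (subL-absorb f fa≡fb) xs ⟩
    map (mapI f) xs                           ∎
    where open ≡-Reasoning

  map-ren-sub : ∀ ρ {a b c e} → e ≢ ε → subL c e (ren ρ a) ≡ subL c e (ren ρ b) → ∀ xs →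
                map (mapI (ren (ρ ⨾[ c / e ]))) (map (subI a b) xs) ≡ map (subI c e) (map (mapI (ren ρ)) xs)
  map-ren-sub ρ {a} {b} {c} {e} e≢ε merges xs = begin
    map (mapI (ren (ρ ⨾[ c / e ]))) (map (subI a b) xs)  ≡⟨ map-sub-absorb (ren (ρ ⨾[ c / e ])) τa≡τb xs ⟩
    map (mapI (ren (ρ ⨾[ c / e ]))) xs                   ≡⟨ map-∘-cong (sym ∘ ren-⨾ e≢ε) xs ⟨
    map (mapI (subL c e)) (map (mapI (ren ρ)) xs)        ≡⟨ map-cong (subI≗mapI c e) _ ⟨
    map (subI c e) (map (mapI (ren ρ)) xs)               ∎
    where
    open ≡-Reasoning
    τa≡τb : ren (ρ ⨾[ c / e ]) a ≡ ren (ρ ⨾[ c / e ]) b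
    τa≡τb = trans (ren-⨾ e≢ε a) (trans merges (sym (ren-⨾ e≢ε b)))

  ↭-ren-absorb : ∀ ρ a b xs {G X} → ren ρ a ≡ ren ρ b →
                 G ↭ map (mapI (ren ρ)) xs ++ X → G ↭ map (mapI (ren ρ)) (map (subI a b) xs) ++ X
  ↭-ren-absorb ρ a b xs {X = X} merges p =
    subst (λ ys → _ ↭ ys ++ X) (sym (map-sub-absorb (ren ρ) merges xs)) p

  ↭-ren-sub : ∀ ρ a b xs {c e G X} → e ≢ ε → subL c e (ren ρ a) ≡ subL c e (ren ρ b) →
              G ↭ map (mapI (ren ρ)) xs ++ X →
              map (subI c e) G ↭ map (mapI (ren (ρ ⨾[ c / e ]))) (map (subI a b) xs) ++ map (subI c e) X
  ↭-ren-sub ρ a b xs {c} {e} {X = X} e≢ε merges p = ↭-trans (map⁺ (subI c e) p) (↭-reflexive (begin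
    map (subI c e) (map (mapI (ren ρ)) xs ++ X)
      ≡⟨ map-++ (subI c e) _ X ⟩
    map (subI c e) (map (mapI (ren ρ)) xs) ++ map (subI c e) X
      ≡⟨ cong (_++ map (subI c e) X) (map-ren-sub ρ e≢ε merges xs) ⟨
    map (mapI (ren (ρ ⨾[ c / e ]))) (map (subI a b) xs) ++ map (subI c e) X ∎))
    where open ≡-Reasoning

  ↭-sub-as-ren : ∀ {y x} → x ≢ ε → ∀ xs → map (subI y x) xs ↭ map (mapI (ren (var ⨾[ y / x ]))) xs ++ []
  ↭-sub-as-ren {y} {x} x≢ε xs = ↭-trans
    (↭-reflexive (map-cong (λ i → trans (subI≗mapI y x i) (mapI-cong-on i λ {l} _ → sym (ren-var-⨾ x≢ε l))) xs))
    (↭-sym (++-identityʳ _))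

open LabelledList mapH labelsH subH mapH-∘ mapH-cong-on subH≗mapH using () renaming
  (map-cong-on to mapΓ-cong-on; ↭-ren-absorb to ↭-ren-absorbΓ; ↭-ren-sub to ↭-ren-subΓ;
   ↭-sub-as-ren to ↭-sub-as-renΓ)
open LabelledList mapLF labelsLF subLF mapLF-∘ mapLF-cong-on subLF≗mapLF using () renaming
  (map-cong-on to mapΔ-cong-on; ↭-ren-absorb to ↭-ren-absorbΔ; ↭-ren-sub to ↭-ren-subΔ;
   ↭-sub-as-ren to ↭-sub-as-renΔ)

module _ {A B : Set} {f : A → B} {G' : List B} {G : List A} {X : List B}
         (p : G' ↭ map f G ++ X) where

  image-∈ : ∀ {a} → a ∈ G → f a ∈ G'
  image-∈ a∈G = ∈-resp-↭ (↭-sym p) (∈-++⁺ˡ (∈-map⁺ f a∈G))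

  image-∷ : ∀ {a G₀} → G ↭ a ∷ G₀ → G' ↭ f a ∷ (map f G₀ ++ X)
  image-∷ q = ↭-trans p (++⁺ʳ X (map⁺ f q))

  image-++ : ∀ G₁ G₂ → G ↭ G₁ ++ G₂ → G' ↭ map f G₁ ++ (map f G₂ ++ X)
  image-++ G₁ G₂ q = ↭-trans p (↭-trans (++⁺ʳ X (map⁺ f q))
    (↭-trans (↭-reflexive (cong (_++ X) (map-++ f G₁ G₂))) (++-assoc (map f G₁) (map f G₂) X)))

↭-cons-≡ : ∀ {A : Set} {x y : A} {xs ys} → x ≡ y → xs ↭ ys → x ∷ xs ↭ y ∷ ys
↭-cons-≡ refl = prep _

index : Label → ℕ
index ε = 0
index (var n) = n

fresh : (L : List Label) → Σ ℕ (λ i → var i ∉ L)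
fresh L = suc (max 0 (map index L)) ,
          λ i∈L → 1+n≰n (All.lookup (xs≤max 0 (map index L)) (∈-map⁺ index i∈L))

record FreshPair (L : List Label) : Set where
  field
    i' j'     : ℕ
    i'-fresh  : var i' ∉ L
    j'-fresh  : var j' ∉ L
    i'≢j'     : i' ≢ j'

fresh₂ : (L : List Label) → FreshPair L
fresh₂ L with fresh L
... | i , i∉L with fresh (var i ∷ L)
... | j , j∉i∷L = record
  { i' = i ; j' = j ; i'-fresh = i∉L ; j'-fresh = j∉i∷L ∘ there ; i'≢j' = λ { refl → j∉i∷L (here refl) } }

ren-update-fresh : ∀ {ρ i t} Γ Δ {l} → Fresh i Γ Δ → l ∈ labels Γ Δ → ren (ρ [ i ≔ t ]) l ≡ ren ρ l
ren-update-fresh Γ Δ {l} i-fresh l∈ = ren-update-≢ l λ { refl → i-fresh l∈ }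

module _ {σ ρ} Γ Δ (agree : ∀ {l} → l ∈ labels Γ Δ → ren σ l ≡ ren ρ l) where

  ↭-ren-agreeΓ : ∀ {Γ' X} → Γ' ↭ mapΓ (ren ρ) Γ ++ X → Γ' ↭ mapΓ (ren σ) Γ ++ X
  ↭-ren-agreeΓ {X = X} = subst (λ G → _ ↭ G ++ X) (sym (mapΓ-cong-on Γ (agree ∘ ∈-++⁺ˡ)))

  ↭-ren-agreeΔ : ∀ {Δ' Y} → Δ' ↭ mapΔ (ren ρ) Δ ++ Y → Δ' ↭ mapΔ (ren σ) Δ ++ Y
  ↭-ren-agreeΔ {Y = Y} = subst (λ D → _ ↭ D ++ Y) (sym (mapΔ-cong-on Δ (agree ∘ ∈-++⁺ʳ _)))

module RenameApart {Γ' Δ' X Y} Γ Δ (ρ : ℕ → Label)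
  (pΓ : Γ' ↭ mapΓ (ren ρ) Γ ++ X) (pΔ : Δ' ↭ mapΔ (ren ρ) Δ ++ Y)
  (w : ℕ) (w-fresh : Fresh w Γ Δ) where

  w' : ℕ
  w' = proj₁ (fresh (labels Γ' Δ'))

  w'-fresh : var w' ∉ labels Γ' Δ'
  w'-fresh = proj₂ (fresh (labels Γ' Δ'))

  τ : ℕ → Label
  τ = ρ [ w ≔ var w' ]

  τw : ren τ (var w) ≡ var w'
  τw = ren-update-≡ ρ w _

  τ-agrees : ∀ {l} → l ∈ labels Γ Δ → ren τ l ≡ ren ρ l
  τ-agrees = ren-update-fresh Γ Δ w-fresh

  pΓτ : Γ' ↭ mapΓ (ren τ) Γ ++ X
  pΓτ = ↭-ren-agreeΓ Γ Δ τ-agrees pΓ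

  pΔτ : Δ' ↭ mapΔ (ren τ) Δ ++ Y
  pΔτ = ↭-ren-agreeΔ Γ Δ τ-agrees pΔ

module RenameApart₂ {Γ' Δ' X Y} Γ Δ (ρ : ℕ → Label)
  (pΓ : Γ' ↭ mapΓ (ren ρ) Γ ++ X) (pΔ : Δ' ↭ mapΔ (ren ρ) Δ ++ Y)
  (i j : ℕ) (i-fresh : Fresh i Γ Δ) (j-fresh : Fresh j Γ Δ) (i≢j : i ≢ j) where

  open FreshPair (fresh₂ (labels Γ' Δ')) public

  τ : ℕ → Label
  τ = (ρ [ j ≔ var j' ]) [ i ≔ var i' ]

  τi : ren τ (var i) ≡ var i'
  τi = ren-update-≡ _ i _

  τj : ren τ (var j) ≡ var j'
  τj = trans (ren-update-≢ (var j) λ { refl → i≢j refl }) (ren-update-≡ ρ j _)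

  τ-agrees : ∀ {l} → l ∈ labels Γ Δ → ren τ l ≡ ren ρ l
  τ-agrees l∈ = trans (ren-update-fresh Γ Δ i-fresh l∈) (ren-update-fresh Γ Δ j-fresh l∈)

  pΓτ : Γ' ↭ mapΓ (ren τ) Γ ++ X
  pΓτ = ↭-ren-agreeΓ Γ Δ τ-agrees pΓ

  pΔτ : Δ' ↭ mapΔ (ren τ) Δ ++ Y
  pΔτ = ↭-ren-agreeΔ Γ Δ τ-agrees pΔ

EqAtom : List Hyp → Label → Label → List Hyp → Set
EqAtom Γ' u v G = (Γ' ↭ rel ε u v ∷ G) ⊎ (Γ' ↭ rel ε v u ∷ G)

eq-rule : ∀ {Γ' Δ' G c e} → e ≢ ε → EqAtom Γ' e c G →
          (d : Der (rel ε c c ∷ subΓ c e G) (subΔ c e Δ')) → Der≤ Γ' Δ' (suc (ht d))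
eq-rule e≢ε (inj₁ p) d = Eq₁ e≢ε p d , ≤-refl
eq-rule e≢ε (inj₂ p) d = Eq₂ e≢ε p d , ≤-refl

EqAtom-diagonal : ∀ {Γ' u G} → EqAtom Γ' u u G → Γ' ↭ rel ε u u ∷ G
EqAtom-diagonal (inj₁ p) = p
EqAtom-diagonal (inj₂ p) = p

rename : ∀ {Γ Δ Γ' Δ'} (d : Der Γ Δ) (ρ : ℕ → Label) (X : List Hyp) (Y : List LF) →
         Γ' ↭ mapΓ (ren ρ) Γ ++ X → Δ' ↭ mapΔ (ren ρ) Δ ++ Y → Der≤ Γ' Δ' (ht d)

rename-Eq : ∀ {Γ₀ Δ Γ' Δ' w w'} (d : Der (rel ε w' w' ∷ subΓ w' w Γ₀) (subΔ w' w Δ))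
            (ρ : ℕ → Label) (X : List Hyp) (Y : List LF) →
            EqAtom Γ' (ren ρ w) (ren ρ w') (mapΓ (ren ρ) Γ₀ ++ X) → Δ' ↭ mapΔ (ren ρ) Δ ++ Y →
            Der≤ Γ' Δ' (suc (ht d))

rename-Eq-merge : ∀ {Γ₀ Δ Γ' Δ' w w' c e} (d : Der (rel ε w' w' ∷ subΓ w' w Γ₀) (subΔ w' w Δ))
                  (ρ : ℕ → Label) (X : List Hyp) (Y : List LF) →
                  e ≢ ε → subL c e (ren ρ w') ≡ c → subL c e (ren ρ w) ≡ c →
                  EqAtom Γ' e c (mapΓ (ren ρ) Γ₀ ++ X) → Δ' ↭ mapΔ (ren ρ) Δ ++ Y →
                  Der≤ Γ' Δ' (suc (ht d))

rename (id P∈Γ P∈Δ) ρ X Y pΓ pΔ = id (image-∈ pΓ P∈Γ) (image-∈ pΔ P∈Δ) , ≤-refl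
rename (⊥L ⊥∈Γ) ρ X Y pΓ pΔ = ⊥L (image-∈ pΓ ⊥∈Γ) , ≤-refl
rename (⊤R ⊤∈Δ) ρ X Y pΓ pΔ = ⊤R (image-∈ pΔ ⊤∈Δ) , ≤-refl
rename (⊤*R ⊤*∈Δ) ρ X Y pΓ pΔ = ⊤*R (image-∈ pΔ ⊤*∈Δ) , ≤-refl
rename (cut {Γ = Γ₁} {Γ₂} {Δ₁} {Δ₂} pΓc pΔc d e) ρ X Y pΓ pΔ =
  let d' , h₁ = rename d ρ [] [] (↭-sym (++-identityʳ _)) (↭-sym (++-identityʳ _))
      e' , h₂ = rename e ρ X Y ↭-refl ↭-refl
  in cut (image-++ pΓ Γ₁ Γ₂ pΓc) (image-++ pΔ Δ₁ Δ₂ pΔc) d' e' , s≤s (⊔-mono-≤ h₁ h₂)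
rename {Δ = Δ} {Γ'} (⊤*L {Γ = Γ₀} {w = w} _ p d) ρ X Y pΓ pΔ with ren ρ w ≟L ε
... | no ρw≢ε =
  let d' , h = rename d (ρ ⨾[ ε / ren ρ w ]) (subΓ ε (ren ρ w) X) (subΔ ε (ren ρ w) Y)
                 (↭-ren-subΓ ρ ε w Γ₀ ρw≢ε merges ↭-refl) (↭-ren-subΔ ρ ε w Δ ρw≢ε merges pΔ)
  in ⊤*L ρw≢ε (image-∷ pΓ p) d' , s≤s h
  where
  merges : subL ε (ren ρ w) ε ≡ subL ε (ren ρ w) (ren ρ w)
  merges = trans (subL-ε ρw≢ε) (sym (subL-self ε (ren ρ w)))
... | yes ρw≡ε =
  let d' , h = rename d ρ (lf (ren ρ w) ⊤* ∷ X) Y PΓ (↭-ren-absorbΔ ρ ε w Δ (sym ρw≡ε) pΔ)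
  in d' , m≤n⇒m≤1+n h
  where
  PΓ : Γ' ↭ mapΓ (ren ρ) (subΓ ε w Γ₀) ++ lf (ren ρ w) ⊤* ∷ X
  PΓ = ↭-trans (image-∷ pΓ p)
         (↭-trans (↭-sym (shift _ (mapΓ (ren ρ) Γ₀) X)) (↭-ren-absorbΓ ρ ε w Γ₀ (sym ρw≡ε) ↭-refl))
rename (∧L p d) ρ X Y pΓ pΔ =
  let d' , h = rename d ρ X Y ↭-refl pΔ in ∧L (image-∷ pΓ p) d' , s≤s h
rename (∧R p d e) ρ X Y pΓ pΔ =
  let d' , h₁ = rename d ρ X Y pΓ ↭-refl
      e' , h₂ = rename e ρ X Y pΓ ↭-refl
  in ∧R (image-∷ pΔ p) d' e' , s≤s (⊔-mono-≤ h₁ h₂)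
rename (⇒L p d e) ρ X Y pΓ pΔ =
  let d' , h₁ = rename d ρ X Y ↭-refl (prep _ pΔ)
      e' , h₂ = rename e ρ X Y ↭-refl pΔ
  in ⇒L (image-∷ pΓ p) d' e' , s≤s (⊔-mono-≤ h₁ h₂)
rename (⇒R p d) ρ X Y pΓ pΔ =
  let d' , h = rename d ρ X Y (prep _ pΓ) ↭-refl in ⇒R (image-∷ pΔ p) d' , s≤s h
rename (✱L {Γc} {Γ₀} {Δ} {z} {φ} {ψ} i j p i-fresh j-fresh i≢j d) ρ X Y pΓ pΔ =
  let d' , h = rename d τ X Y PΓ pΔτ
  in ✱L i' j' (image-∷ pΓτ p) i'-fresh j'-fresh i'≢j' d' , s≤s h
  where
  open RenameApart₂ Γc Δ ρ pΓ pΔ i j i-fresh j-fresh i≢j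
  PΓ : rel (var i') (var j') (ren τ z) ∷ lf (var i') φ ∷ lf (var j') ψ ∷ (mapΓ (ren τ) Γ₀ ++ X)
       ↭ mapΓ (ren τ) (rel (var i) (var j) z ∷ lf (var i) φ ∷ lf (var j) ψ ∷ Γ₀) ++ X
  PΓ = ↭-cons-≡ (rel-cong (sym τi) (sym τj) refl)
         (↭-cons-≡ (cong (λ t → lf t φ) (sym τi)) (↭-cons-≡ (cong (λ t → lf t ψ) (sym τj)) ↭-refl))
rename {Γ' = Γ'} (-✱R {Γ} {Δc} {Δ₀} {y} {φ} {ψ} i k p i-fresh k-fresh i≢k d) ρ X Y pΓ pΔ =
  let d' , h = rename d τ X Y PΓ PΔ
  in -✱R i' k' (image-∷ pΔτ p) i'-fresh k'-fresh i'≢k' d' , s≤s h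
  where
  open RenameApart₂ Γ Δc ρ pΓ pΔ i k i-fresh k-fresh i≢k
    renaming (j' to k'; j'-fresh to k'-fresh; i'≢j' to i'≢k'; τj to τk)
  PΓ : rel (var i') (ren τ y) (var k') ∷ lf (var i') φ ∷ Γ'
       ↭ mapΓ (ren τ) (rel (var i) y (var k) ∷ lf (var i) φ ∷ Γ) ++ X
  PΓ = ↭-cons-≡ (rel-cong (sym τi) refl (sym τk)) (↭-cons-≡ (cong (λ t → lf t φ) (sym τi)) pΓτ)
  PΔ : (var k' , ψ) ∷ (mapΔ (ren τ) Δ₀ ++ Y) ↭ mapΔ (ren τ) ((var k , ψ) ∷ Δ₀) ++ Y
  PΔ = ↭-cons-≡ (cong (λ t → (t , ψ)) (sym τk)) ↭-refl
rename (✱R xy▷z z∈Δ d e) ρ X Y pΓ pΔ =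
  let d' , h₁ = rename d ρ X Y pΓ (prep _ pΔ)
      e' , h₂ = rename e ρ X Y pΓ (prep _ pΔ)
  in ✱R (image-∈ pΓ xy▷z) (image-∈ pΔ z∈Δ) d' e' , s≤s (⊔-mono-≤ h₁ h₂)
rename (-✱L xy▷z y∈Γ d e) ρ X Y pΓ pΔ =
  let d' , h₁ = rename d ρ X Y pΓ (prep _ pΔ)
      e' , h₂ = rename e ρ X Y (prep _ pΓ) pΔ
  in -✱L (image-∈ pΓ xy▷z) (image-∈ pΓ y∈Γ) d' e' , s≤s (⊔-mono-≤ h₁ h₂)
rename (E xy▷z d) ρ X Y pΓ pΔ =
  let d' , h = rename d ρ X Y (prep _ pΓ) pΔ in E (image-∈ pΓ xy▷z) d' , s≤s h
rename (U x d) ρ X Y pΓ pΔ =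
  let d' , h = rename d ρ X Y (prep _ pΓ) pΔ in U (ren ρ x) d' , s≤s h
rename {Γ} {Δ} {Γ'} (A {y = y} {z} {u} {v} w xy▷z uv▷x w-fresh d) ρ X Y pΓ pΔ =
  let d' , h = rename d τ X Y PΓ pΔτ
  in A w' (image-∈ pΓτ xy▷z) (image-∈ pΓτ uv▷x) w'-fresh d' , s≤s h
  where
  open RenameApart Γ Δ ρ pΓ pΔ w w-fresh
  PΓ : rel (ren τ u) (var w') (ren τ z) ∷ rel (ren τ y) (ren τ v) (var w') ∷ Γ'
       ↭ mapΓ (ren τ) (rel u (var w) z ∷ rel y v (var w) ∷ Γ) ++ X
  PΓ = ↭-cons-≡ (rel-cong refl (sym τw) refl) (↭-cons-≡ (rel-cong refl refl (sym τw)) pΓτ)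
rename {Γ} {Δ} {Γ'} (AC {x = x} {y} w xy▷x w-fresh d) ρ X Y pΓ pΔ =
  let d' , h = rename d τ X Y PΓ pΔτ
  in AC w' (image-∈ pΓτ xy▷x) w'-fresh d' , s≤s h
  where
  open RenameApart Γ Δ ρ pΓ pΔ w w-fresh
  PΓ : rel (ren τ x) (var w') (ren τ x) ∷ rel (ren τ y) (ren τ y) (var w') ∷ Γ'
       ↭ mapΓ (ren τ) (rel x (var w) x ∷ rel y y (var w) ∷ Γ) ++ X
  PΓ = ↭-cons-≡ (rel-cong refl (sym τw) refl) (↭-cons-≡ (rel-cong refl refl (sym τw)) pΓτ)
rename (Eq₁ _ p d) ρ X Y pΓ pΔ = rename-Eq d ρ X Y (inj₁ (image-∷ pΓ p)) pΔ
rename (Eq₂ _ p d) ρ X Y pΓ pΔ = rename-Eq d ρ X Y (inj₂ (image-∷ pΓ p)) pΔ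

rename-Eq {Γ₀} {Δ} {Γ'} {w = w} {w'} d ρ X Y q pΔ with ren ρ w ≟L ε | ren ρ w' ≟L ε
... | no ρw≢ε | _ =
  rename-Eq-merge d ρ X Y ρw≢ε (subL-target (ren ρ w') (ren ρ w)) (subL-self (ren ρ w') (ren ρ w)) q pΔ
... | yes ρw≡ε | no ρw'≢ε =
  rename-Eq-merge d ρ X Y ρw'≢ε (subL-self ε (ren ρ w'))
    (trans (cong (subL ε (ren ρ w')) ρw≡ε) (subL-ε ρw'≢ε)) (swap (subst (λ u → EqAtom _ u _ _) ρw≡ε q)) pΔ
... | yes ρw≡ε | yes ρw'≡ε =
  let d' , h = rename d ρ X Y PΓ (↭-ren-absorbΔ ρ w' w Δ merges pΔ) in d' , m≤n⇒m≤1+n h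
  where
  merges : ren ρ w' ≡ ren ρ w
  merges = trans ρw'≡ε (sym ρw≡ε)
  PΓ : Γ' ↭ mapΓ (ren ρ) (rel ε w' w' ∷ subΓ w' w Γ₀) ++ X
  PΓ = ↭-trans (EqAtom-diagonal (subst (λ u → EqAtom _ u _ _) (sym merges) q))
               (prep _ (↭-ren-absorbΓ ρ w' w Γ₀ merges ↭-refl))

rename-Eq-merge {Γ₀} {Δ} {w = w} {w'} {c} {e} d ρ X Y e≢ε w'↦c w↦c q pΔ =
  let d' , h = rename d (ρ ⨾[ c / e ]) (subΓ c e X) (subΔ c e Y) PΓ (↭-ren-subΔ ρ w' w Δ e≢ε merges pΔ)
      d'' , h' = eq-rule e≢ε q d'
  in d'' , ≤-trans h' (s≤s h)
  where
  merges : subL c e (ren ρ w') ≡ subL c e (ren ρ w)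
  merges = trans w'↦c (sym w↦c)
  τw' : ren (ρ ⨾[ c / e ]) w' ≡ c
  τw' = trans (ren-⨾ e≢ε w') w'↦c
  PΓ : rel ε c c ∷ subΓ c e (mapΓ (ren ρ) Γ₀ ++ X)
       ↭ mapΓ (ren (ρ ⨾[ c / e ])) (rel ε w' w' ∷ subΓ w' w Γ₀) ++ subΓ c e X
  PΓ = ↭-cons-≡ (rel-cong refl (sym τw') (sym τw')) (↭-ren-subΓ ρ w' w Γ₀ e≢ε merges ↭-refl)

lemma1 : {Γ : List Hyp} {Δ : List LF} (Π : Der Γ Δ) (x y : Label) → x ≢ ε →
    Σ (Der (subΓ y x Γ) (subΔ y x Δ)) (λ Π' → ht Π' ≤ ht Π)
lemma1 {Γ} {Δ} Π x y x≢ε = rename Π (var ⨾[ y / x ]) [] [] (↭-sub-as-renΓ x≢ε Γ) (↭-sub-as-renΔ x≢ε Δ)
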